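{- Let $\ell_1,\ell_2$ be integers with $1<\ell_2=\ell_1-1$, let $\mathscr{M}=\{(a,b)\in\mathbb{Z}^2: 0\le a\le\ell_1-1,\ 0\le b\le\ell_2-1\}$ with the componentwise order, and let $\mathrm{wt}$ be a rank increasing and rank constant weight function on $\mathscr{M}$. Let $A\subseteq\mathscr{M}$ be a downset. (1) If $A$ is the initial segment of size $|A|$ of $\mathcal{L}$, then $A$ is optimal if and only if $|A|\le\ell_2$, or $|A|\ge\ell_2(\ell_1-1)$, or $|A|=k\ell_2$ for some $k\in\mathbb{N}$. (2) If $A$ is the initial segment of size $|A|$ of $\mathcal{C}$, then $A$ is optimal.
   Context: The rank of $(a,b)$ is $a+b$; $\mathrm{wt}$ is rank constant if equal ranks give equal weights and rank increasing if strictly smaller rank gives strictly smaller weight; $\mathrm{wt}(S)=\sum_{s\in S}\mathrm{wt}(s)$. A downset is a subset closed downward in the componentwise order; it is optimal if its weight is at least that of every downset of the same size. $\mathcal{L}$: $(a,b)<(c,d)$ iff $a<c$, or $a=c$ and $b<d$. $\mathcal{C}$: $(a,b)<(c,d)$ iff $b<d$, or $b=d$ and $a<c$. The initial segment of size $m$ is the set of the $m$ smallest elements. $\mathbb{N}$ includes $0$.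
   Formalization: The weight function wt takes rational values rather than real values. -}

module Defs where

open import Data.Bool using (Bool; true; false; T; _∧_; _∨_)
open import Data.Nat using (ℕ; _<ᵇ_; _≡ᵇ_; _≤ᵇ_; _+_; _<_)
open import Data.Fin using (Fin; toℕ)
open import Data.List using (List; filter; length; map; foldr; cartesianProduct; allFin)
open import Data.Product using (_×_; _,_)
open import Data.Rational using (ℚ; 0ℚ) renaming (_+_ to _+ℚ_; _≤_ to _≤ℚ_; _<_ to _<ℚ_)
open import Relation.Binary.PropositionalEquality using (_≡_)
open import Relation.Nullary.Decidable using (T?)
open import Function using (_⇔_)

Point : ℕ → ℕ → Set
Point ℓ₁ ℓ₂ = Fin ℓ₁ × Fin ℓ₂

points : (ℓ₁ ℓ₂ : ℕ) → List (Point ℓ₁ ℓ₂)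
points ℓ₁ ℓ₂ = cartesianProduct (allFin ℓ₁) (allFin ℓ₂)

SubsetM : ℕ → ℕ → Set
SubsetM ℓ₁ ℓ₂ = Point ℓ₁ ℓ₂ → Bool

elemsOf : ∀ {ℓ₁ ℓ₂} → SubsetM ℓ₁ ℓ₂ → List (Point ℓ₁ ℓ₂)
elemsOf {ℓ₁} {ℓ₂} S = filter (λ p → T? (S p)) (points ℓ₁ ℓ₂)

size : ∀ {ℓ₁ ℓ₂} → SubsetM ℓ₁ ℓ₂ → ℕ
size S = length (elemsOf S)

rank : ∀ {ℓ₁ ℓ₂} → Point ℓ₁ ℓ₂ → ℕ
rank (a , b) = toℕ a + toℕ b

_≼_ : ∀ {ℓ₁ ℓ₂} → Point ℓ₁ ℓ₂ → Point ℓ₁ ℓ₂ → Set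
(a , b) ≼ (c , d) = T (toℕ a ≤ᵇ toℕ c) × T (toℕ b ≤ᵇ toℕ d)

Weight : ℕ → ℕ → Set
Weight ℓ₁ ℓ₂ = Point ℓ₁ ℓ₂ → ℚ

RankConstant : ∀ {ℓ₁ ℓ₂} → Weight ℓ₁ ℓ₂ → Set
RankConstant wt = ∀ p q → rank p ≡ rank q → wt p ≡ wt q

RankIncreasing : ∀ {ℓ₁ ℓ₂} → Weight ℓ₁ ℓ₂ → Set
RankIncreasing wt = ∀ p q → rank p < rank q → wt p <ℚ wt q

wtSet : ∀ {ℓ₁ ℓ₂} → Weight ℓ₁ ℓ₂ → SubsetM ℓ₁ ℓ₂ → ℚ
wtSet wt S = foldr _+ℚ_ 0ℚ (map wt (elemsOf S))

Downset : ∀ {ℓ₁ ℓ₂} → SubsetM ℓ₁ ℓ₂ → Set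
Downset S = ∀ p q → p ≼ q → S q ≡ true → S p ≡ true

Optimal : ∀ {ℓ₁ ℓ₂} → Weight ℓ₁ ℓ₂ → SubsetM ℓ₁ ℓ₂ → Set
Optimal wt A = Downset A × (∀ B → Downset B → size B ≡ size A → wtSet wt B ≤ℚ wtSet wt A)

_<L_ : ∀ {ℓ₁ ℓ₂} → Point ℓ₁ ℓ₂ → Point ℓ₁ ℓ₂ → Bool
(a , b) <L (c , d) = (toℕ a <ᵇ toℕ c) ∨ ((toℕ a ≡ᵇ toℕ c) ∧ (toℕ b <ᵇ toℕ d))

_<C_ : ∀ {ℓ₁ ℓ₂} → Point ℓ₁ ℓ₂ → Point ℓ₁ ℓ₂ → Bool
(a , b) <C (c , d) = (toℕ b <ᵇ toℕ d) ∨ ((toℕ b ≡ᵇ toℕ d) ∧ (toℕ a <ᵇ toℕ c))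

below : ∀ {ℓ₁ ℓ₂} → (Point ℓ₁ ℓ₂ → Point ℓ₁ ℓ₂ → Bool) → Point ℓ₁ ℓ₂ → ℕ
below {ℓ₁} {ℓ₂} _<o_ p = length (filter (λ q → T? (q <o p)) (points ℓ₁ ℓ₂))

-- S is the initial segment of size m of the total order _<o_:
-- S consists exactly of the m smallest elements, i.e. those with fewer than m elements below them.
IsInitialSegment : ∀ {ℓ₁ ℓ₂} → (Point ℓ₁ ℓ₂ → Point ℓ₁ ℓ₂ → Bool) → SubsetM ℓ₁ ℓ₂ → ℕ → Set
IsInitialSegment _<o_ S m = ∀ p → (S p ≡ true) ⇔ (below _<o_ p < m)

-- Write ℓ₁ = n + 1 and ℓ₂ = n. Since wt depends only on the rank and increases strictly with it,
-- a set A is at least as heavy as a set B of the same size as soon as, for every r, A has at least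
-- as many elements of rank ≥ r as B (remove an element of maximal rank from each and induct), and
-- strictly heavier if one of these counts is strictly larger. Every downset of the grid is
-- dominated in this sense by the set that fills rows of length n + 1 one after another, which is
-- the C-segment: a full bottom row can be removed, a downset missing the corner (n, 0) is either
-- transposed or squeezed into a smaller square box, and lengthening rows never hurts. The
-- L-segment fills rows of length n of the transposed grid. For |A| = q n + s, passing from rows
-- of length n to rows of length n + 1 exchanges the ranks max(q,s), …, max(q,s) + min(q,s) - 1 for
-- n, …, n + min(q,s) - 1. Both fillings therefore have the same rank counts when min(q,s) = 0 or
-- max(q,s) = n, which is the stated condition on |A|, and otherwise the C-segment is strictly
-- heavier.

module Submission where

open import Algebra.Bundles using (CommutativeMonoid)
import Algebra.Properties.CommutativeSemigroup as CommutativeSemigroupProperties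
open import Data.Bool using (Bool; true; false; T; _∧_; _∨_)
open import Data.Empty using (⊥-elim)
open import Data.Fin using (Fin; toℕ; fromℕ<)
open import Data.Fin.Properties using (toℕ<n; fromℕ<-toℕ; toℕ-fromℕ<)
open import Data.List using (List; []; _∷_; _++_; length; map; foldr; filter; cartesianProduct; allFin; tabulate)
open import Data.List.Properties using (map-++; map-cong; map-∘; map-tabulate)
open import Data.Nat
  using (ℕ; zero; suc; _+_; _*_; _∸_; _⊔_; _⊓_; _≤_; _<_; _≤ᵇ_; _<ᵇ_; _≡ᵇ_; _≤?_; _<?_; _≟_;
         z≤n; s≤s; z<s; s<s; s≤s⁻¹; s<s⁻¹; NonZero; >-nonZero)
open import Data.Nat.DivMod using (_/_; _%_; m%n<n; m≡m%n+[m/n]*n)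
open import Data.Nat.ListAction using (sum)
open import Data.Nat.ListAction.Properties using (sum-++)
open import Data.Nat.Properties
  using (≤-refl; ≤-reflexive; ≤-trans; ≤-antisym; <-trans; <-≤-trans; ≤-<-trans; <⇒≤; ≰⇒>; ≮⇒≥; <⇒≱; <⇒≢;
         ≤∧≢⇒<; n≤1+n; m≤m+n; m≤n+m; suc-injective; ≤⇒≤ᵇ; ≤ᵇ⇒≤; <⇒<ᵇ; <ᵇ⇒<; ≡⇒≡ᵇ; ≡ᵇ⇒≡;
         +-assoc; +-comm; +-identityʳ; +-suc; +-commutativeSemigroup; +-mono-≤; +-monoʳ-≤; +-monoˡ-≤; +-monoʳ-<;
         *-comm; *-suc; *-identityʳ; *-zeroʳ; *-monoˡ-≤; *-monoʳ-≤; *-cancelʳ-≤; *-cancelʳ-<;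
         m+[n∸m]≡n; m≤n+o⇒m∸n≤o; m≤n⇒∃[o]m+o≡n;
         m≤n⇒m⊔n≡n; m≥n⇒m⊔n≡m; m≤n⇒m⊓n≡m; m≥n⇒m⊓n≡n; ⊔-lub; m⊔n<o⇒m<o; m⊔n<o⇒n<o; module ≤-Reasoning)
open import Data.Nat.Tactic.RingSolver using (solve-∀)
open import Data.Product using (_×_; _,_; proj₁; proj₂; ∃; ∃-syntax)
open import Data.Rational using (ℚ; 0ℚ) renaming (_+_ to _+ℚ_; _≤_ to _≤ℚ_; _<_ to _<ℚ_)
import Data.Rational.Properties as ℚ
open import Data.Sum using (_⊎_; inj₁; inj₂)
open import Function using (Equivalence; id; _⇔_; mk⇔)
open import Relation.Binary.PropositionalEquality
  using (_≡_; _≢_; refl; sym; trans; cong; cong₂; subst; subst₂; module ≡-Reasoning)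
open import Relation.Nullary using (¬_; yes; no)
open import Relation.Nullary.Decidable using (T?)

open import Defs

private
  module ℕ+ = CommutativeSemigroupProperties +-commutativeSemigroup

[_] : Bool → ℕ
[ true ] = 1
[ false ] = 0

T⇒≡true : ∀ {b} → T b → b ≡ true
T⇒≡true {true} _ = refl

≡true⇒T : ∀ {b} → b ≡ true → T b
≡true⇒T {true} _ = _

¬T⇒≡false : ∀ {b} → ¬ T b → b ≡ false
¬T⇒≡false {false} _ = refl
¬T⇒≡false {true} ¬t = ⊥-elim (¬t _)

T-ext : ∀ {b c} → (T b → T c) → (T c → T b) → b ≡ c
T-ext {false} {false} _ _ = refl
T-ext {false} {true} _ c⇒b = ⊥-elim (c⇒b _)
T-ext {true} {false} b⇒c _ = ⊥-elim (b⇒c _)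
T-ext {true} {true} _ _ = refl

<ᵇ-true : ∀ {x y} → x < y → (x <ᵇ y) ≡ true
<ᵇ-true x<y = T⇒≡true (<⇒<ᵇ x<y)

<ᵇ-false : ∀ {x y} → y ≤ x → (x <ᵇ y) ≡ false
<ᵇ-false y≤x = ¬T⇒≡false (λ t → <⇒≱ (<ᵇ⇒< _ _ t) y≤x)

≤ᵇ-true : ∀ {x y} → x ≤ y → (x ≤ᵇ y) ≡ true
≤ᵇ-true x≤y = T⇒≡true (≤⇒≤ᵇ x≤y)

≤ᵇ-false : ∀ {x y} → y < x → (x ≤ᵇ y) ≡ false
≤ᵇ-false y<x = ¬T⇒≡false (λ t → <⇒≱ y<x (≤ᵇ⇒≤ _ _ t))

[≤ᵇ]≡1 : ∀ {r x} → r ≤ x → [ r ≤ᵇ x ] ≡ 1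
[≤ᵇ]≡1 r≤x = cong [_] (≤ᵇ-true r≤x)

[≤ᵇ]≡0 : ∀ {r x} → x < r → [ r ≤ᵇ x ] ≡ 0
[≤ᵇ]≡0 x<r = cong [_] (≤ᵇ-false x<r)

[≤ᵇ]-mono : ∀ r {x y} → x ≤ y → [ r ≤ᵇ x ] ≤ [ r ≤ᵇ y ]
[≤ᵇ]-mono r {x} {y} x≤y with r ≤? x
... | yes r≤x = ≤-reflexive (trans ([≤ᵇ]≡1 r≤x) (sym ([≤ᵇ]≡1 (≤-trans r≤x x≤y))))
... | no r≰x = subst (_≤ [ r ≤ᵇ y ]) (sym ([≤ᵇ]≡0 (≰⇒> r≰x))) z≤n

≤ᵇ-suc : ∀ r k → (r ≤ᵇ suc k) ≡ (r ∸ 1 ≤ᵇ k)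
≤ᵇ-suc zero k = refl
≤ᵇ-suc (suc zero) k = refl
≤ᵇ-suc (suc (suc r)) k = refl

≡ᵇ-refl : ∀ x → (x ≡ᵇ x) ≡ true
≡ᵇ-refl x = T⇒≡true (≡⇒≡ᵇ x x refl)

≡ᵇ-false : ∀ {x y} → x ≢ y → (x ≡ᵇ y) ≡ false
≡ᵇ-false x≢y = ¬T⇒≡false (λ t → x≢y (≡ᵇ⇒≡ _ _ t))

∧-true : ∀ {x y} → (x ∧ y) ≡ true → x ≡ true × y ≡ true
∧-true {true} {true} _ = refl , refl

<ᵇ-cancelˡ : ∀ k {x y} → (k + x <ᵇ k + y) ≡ (x <ᵇ y)
<ᵇ-cancelˡ zero = refl
<ᵇ-cancelˡ (suc k) = <ᵇ-cancelˡ k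

-- Dominance of rank counts

module RankTail {A : Set} (rank : A → ℕ) where

  rankTail : ℕ → List A → ℕ
  rankTail r [] = 0
  rankTail r (x ∷ xs) = [ r ≤ᵇ rank x ] + rankTail r xs

  rankTail-zero : ∀ xs → rankTail 0 xs ≡ length xs
  rankTail-zero [] = refl
  rankTail-zero (x ∷ xs) = cong suc (rankTail-zero xs)

module Majorization {A : Set} (rank : A → ℕ) (w : A → ℚ)
  (w-constant : ∀ x y → rank x ≡ rank y → w x ≡ w y)
  (w-increasing : ∀ x y → rank x < rank y → w x <ℚ w y) where

  w-mono : ∀ x y → rank x ≤ rank y → w x ≤ℚ w y
  w-mono x y rx≤ry with rank x <? rank y
  ... | yes rx<ry = ℚ.<⇒≤ (w-increasing x y rx<ry)
  ... | no rx≮ry = ℚ.≤-reflexive (w-constant x y (≤-antisym rx≤ry (≮⇒≥ rx≮ry)))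

  open RankTail rank public

  weight : List A → ℚ
  weight xs = foldr _+ℚ_ 0ℚ (map w xs)

  _≼ₜ_ : List A → List A → Set
  xs ≼ₜ ys = ∀ r → rankTail r xs ≤ rankTail r ys

  record MaxSplit (xs : List A) : Set where
    field
      top : A
      rest : List A
      rankTail-split : ∀ r → rankTail r xs ≡ [ r ≤ᵇ rank top ] + rankTail r rest
      weight-split : weight xs ≡ w top +ℚ weight rest
      length-split : length xs ≡ suc (length rest)
      top-maximal : ∀ r → rank top < r → rankTail r xs ≡ 0

    rankTail-below : ∀ {r} → r ≤ rank top → rankTail r xs ≡ suc (rankTail r rest)
    rankTail-below {r} r≤top = trans (rankTail-split r) (cong (_+ rankTail r rest) ([≤ᵇ]≡1 r≤top))

    rankTail-above : ∀ {r} → rank top < r → rankTail r xs ≡ rankTail r rest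
    rankTail-above {r} top<r = trans (rankTail-split r) (cong (_+ rankTail r rest) ([≤ᵇ]≡0 top<r))

  open MaxSplit

  private
    module ℚ+ = CommutativeSemigroupProperties (CommutativeMonoid.commutativeSemigroup ℚ.+-0-commutativeMonoid)

  maxSplit : ∀ x xs → MaxSplit (x ∷ xs)
  maxSplit x [] = record
    { top = x ; rest = [] ; rankTail-split = λ _ → refl ; weight-split = refl ; length-split = refl
    ; top-maximal = λ r x<r → cong (_+ 0) ([≤ᵇ]≡0 x<r) }
  maxSplit x (y ∷ ys) with maxSplit y ys | rank x ≤? rank (top (maxSplit y ys))
  ... | s | yes x≤top = record
    { top = top s ; rest = x ∷ rest s
    ; rankTail-split = λ r → trans (cong ([ r ≤ᵇ rank x ] +_) (rankTail-split s r))
                                   (ℕ+.x∙yz≈y∙xz [ r ≤ᵇ rank x ] [ r ≤ᵇ rank (top s) ] (rankTail r (rest s)))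
    ; weight-split = trans (cong (w x +ℚ_) (weight-split s)) (ℚ+.x∙yz≈y∙xz (w x) (w (top s)) (weight (rest s)))
    ; length-split = cong suc (length-split s)
    ; top-maximal = λ r top<r → cong₂ _+_ ([≤ᵇ]≡0 (≤-<-trans x≤top top<r)) (top-maximal s r top<r) }
  ... | s | no x≰top = record
    { top = x ; rest = y ∷ ys ; rankTail-split = λ _ → refl ; weight-split = refl ; length-split = refl
    ; top-maximal = λ r x<r → cong₂ _+_ ([≤ᵇ]≡0 x<r) (top-maximal s r (<-trans (≰⇒> x≰top) x<r)) }

  rest-length : ∀ {xs n} (s : MaxSplit xs) → length xs ≡ suc n → length (rest s) ≡ n
  rest-length s len = suc-injective (trans (sym (length-split s)) len)

  top-rank-≤ : ∀ {xs ys} (sx : MaxSplit xs) (sy : MaxSplit ys) → xs ≼ₜ ys → rank (top sx) ≤ rank (top sy)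
  top-rank-≤ sx sy xs≼ys with rank (top sx) ≤? rank (top sy)
  ... | yes tops = tops
  ... | no tops≰ with subst₂ _≤_ (rankTail-below sx ≤-refl) (top-maximal sy _ (≰⇒> tops≰)) (xs≼ys (rank (top sx)))
  ...   | ()

  rest-≼ₜ : ∀ {xs ys} (sx : MaxSplit xs) (sy : MaxSplit ys) → rank (top sx) ≤ rank (top sy)
          → xs ≼ₜ ys → rest sx ≼ₜ rest sy
  rest-≼ₜ sx sy tops xs≼ys r with rank (top sx) <? r
  ... | yes above = subst (_≤ _) (trans (sym (top-maximal sx r above)) (rankTail-above sx above)) z≤n
  ... | no below = s≤s⁻¹ (subst₂ _≤_ (rankTail-below sx r≤) (rankTail-below sy (≤-trans r≤ tops)) (xs≼ys r))
    where
      r≤ : r ≤ rank (top sx)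
      r≤ = ≮⇒≥ below

  rest-strict : ∀ {xs ys} (sx : MaxSplit xs) (sy : MaxSplit ys) → rank (top sx) ≡ rank (top sy)
              → ∀ {r} → rankTail r xs < rankTail r ys → rankTail r (rest sx) < rankTail r (rest sy)
  rest-strict sx sy tops {r} lt with rank (top sx) <? r
  ... | yes above = subst₂ _<_ (rankTail-above sx above) (rankTail-above sy (subst (_< r) tops above)) lt
  ... | no below = s<s⁻¹ (subst₂ _<_ (rankTail-below sx r≤) (rankTail-below sy (subst (r ≤_) tops r≤)) lt)
    where
      r≤ : r ≤ rank (top sx)
      r≤ = ≮⇒≥ below

  weight-mono : ∀ {n} xs ys → length xs ≡ n → length ys ≡ n → xs ≼ₜ ys → weight xs ≤ℚ weight ys
  weight-mono {zero} [] [] _ _ _ = ℚ.≤-refl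
  weight-mono {suc n} (x ∷ xs) (y ∷ ys) lx ly xs≼ys =
    subst₂ _≤ℚ_ (sym (weight-split sx)) (sym (weight-split sy))
      (ℚ.+-mono-≤ (w-mono _ _ tops)
        (weight-mono (rest sx) (rest sy) (rest-length sx lx) (rest-length sy ly) (rest-≼ₜ sx sy tops xs≼ys)))
    where
      sx : MaxSplit (x ∷ xs)
      sx = maxSplit x xs
      sy : MaxSplit (y ∷ ys)
      sy = maxSplit y ys
      tops : rank (top sx) ≤ rank (top sy)
      tops = top-rank-≤ sx sy xs≼ys

  weight-strict : ∀ {n} xs ys → length xs ≡ n → length ys ≡ n → xs ≼ₜ ys
                → ∀ r → rankTail r xs < rankTail r ys → weight xs <ℚ weight ys
  weight-strict {suc n} (x ∷ xs) (y ∷ ys) lx ly xs≼ys r lt = peel (maxSplit x xs) (maxSplit y ys)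
    where
      peel : (sx : MaxSplit (x ∷ xs)) (sy : MaxSplit (y ∷ ys)) → weight (x ∷ xs) <ℚ weight (y ∷ ys)
      peel sx sy with rank (top sx) <? rank (top sy)
      ... | yes tops< =
        subst₂ _<ℚ_ (sym (weight-split sx)) (sym (weight-split sy))
          (ℚ.+-mono-<-≤ (w-increasing _ _ tops<)
            (weight-mono (rest sx) (rest sy) (rest-length sx lx) (rest-length sy ly)
              (rest-≼ₜ sx sy (<⇒≤ tops<) xs≼ys)))
      ... | no tops≮ =
        subst₂ _<ℚ_ (sym (weight-split sx)) (sym (weight-split sy))
          (ℚ.+-mono-≤-< (w-mono _ _ tops)
            (weight-strict (rest sx) (rest sy) (rest-length sx lx) (rest-length sy ly) (rest-≼ₜ sx sy tops xs≼ys) r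
              (rest-strict sx sy (≤-antisym tops (≮⇒≥ tops≮)) lt)))
        where
          tops : rank (top sx) ≤ rank (top sy)
          tops = top-rank-≤ sx sy xs≼ys

-- Finite sums

∑< : ℕ → (ℕ → ℕ) → ℕ
∑< zero f = 0
∑< (suc n) f = f 0 + ∑< n (λ i → f (suc i))

∑<-cong : ∀ n {f g} → (∀ i → i < n → f i ≡ g i) → ∑< n f ≡ ∑< n g
∑<-cong zero f≡g = refl
∑<-cong (suc n) f≡g = cong₂ _+_ (f≡g 0 z<s) (∑<-cong n (λ i i<n → f≡g (suc i) (s<s i<n)))

∑<-mono : ∀ n {f g} → (∀ i → i < n → f i ≤ g i) → ∑< n f ≤ ∑< n g
∑<-mono zero f≤g = z≤n
∑<-mono (suc n) f≤g = +-mono-≤ (f≤g 0 z<s) (∑<-mono n (λ i i<n → f≤g (suc i) (s<s i<n)))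

∑<-zero : ∀ n {f} → (∀ i → i < n → f i ≡ 0) → ∑< n f ≡ 0
∑<-zero zero f≡0 = refl
∑<-zero (suc n) f≡0 = cong₂ _+_ (f≡0 0 z<s) (∑<-zero n (λ i i<n → f≡0 (suc i) (s<s i<n)))

∑<-+ : ∀ n f g → ∑< n (λ i → f i + g i) ≡ ∑< n f + ∑< n g
∑<-+ zero f g = refl
∑<-+ (suc n) f g = trans (cong (f 0 + g 0 +_) (∑<-+ n _ _)) (ℕ+.interchange (f 0) (g 0) _ _)

∑<-split : ∀ m n f → ∑< (m + n) f ≡ ∑< m f + ∑< n (λ i → f (m + i))
∑<-split zero n f = refl
∑<-split (suc m) n f = trans (cong (f 0 +_) (∑<-split m n _)) (sym (+-assoc (f 0) _ _))

∑<-last : ∀ n f → ∑< (suc n) f ≡ ∑< n f + f n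
∑<-last n f = trans (cong (λ k → ∑< k f) (+-comm 1 n))
  (trans (∑<-split n 1 f) (cong (∑< n f +_) (trans (+-identityʳ (f (n + 0))) (cong f (+-identityʳ n)))))

∑<-swap : ∀ m n (f : ℕ → ℕ → ℕ) → ∑< m (λ i → ∑< n (f i)) ≡ ∑< n (λ j → ∑< m (λ i → f i j))
∑<-swap zero n f = sym (∑<-zero n (λ _ _ → refl))
∑<-swap (suc m) n f = trans (cong (∑< n (f 0) +_) (∑<-swap m n _)) (sym (∑<-+ n (f 0) _))

∑<-const : ∀ n c → ∑< n (λ _ → c) ≡ n * c
∑<-const zero c = refl
∑<-const (suc n) c = cong (c +_) (∑<-const n c)

∑<-≤-const : ∀ n c {f} → (∀ i → i < n → f i ≤ c) → ∑< n f ≤ n * c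
∑<-≤-const n c f≤c = subst (_ ≤_) (∑<-const n c) (∑<-mono n f≤c)

∑<-prefix : ∀ {n} k {f g} → k ≤ n → (∀ i → i < k → f i ≡ g i) → (∀ i → k ≤ i → i < n → f i ≡ 0)
          → ∑< n f ≡ ∑< k g
∑<-prefix {n} k {f} k≤n f≡g f≡0 with m≤n⇒∃[o]m+o≡n k≤n
... | d , refl = trans (∑<-split k d f)
  (trans (cong₂ _+_ (∑<-cong k f≡g) (∑<-zero d (λ i i<d → f≡0 (k + i) (m≤m+n k i) (+-monoʳ-< k i<d))))
         (+-identityʳ _))

∑<-[<ᵇ] : ∀ {Y b} → b ≤ Y → ∑< Y (λ i → [ i <ᵇ b ]) ≡ b
∑<-[<ᵇ] {b = b} b≤Y = trans (∑<-prefix b b≤Y (λ i i<b → cong [_] (<ᵇ-true i<b)) (λ i b≤i _ → cong [_] (<ᵇ-false b≤i)))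
                            (trans (∑<-const b 1) (*-identityʳ b))

quotRem : ∀ m L .{{_ : NonZero L}} → ∃[ q ] ∃[ s ] s < L × m ≡ q * L + s
quotRem m L = m / L , m % L , m%n<n m L , trans (m≡m%n+[m/n]*n m L) (+-comm (m % L) _)

runTail : ℕ → ℕ → ℕ → ℕ
runTail u len r = ∑< len (λ i → [ r ≤ᵇ u + i ])

runTail-mono : ∀ {u u′} len r → u ≤ u′ → runTail u len r ≤ runTail u′ len r
runTail-mono len r u≤u′ = ∑<-mono len (λ i _ → [≤ᵇ]-mono r (+-monoˡ-≤ i u≤u′))

runTail-split : ∀ u x y r → runTail u (x + y) r ≡ runTail u x r + runTail (u + x) y r
runTail-split u x y r = trans (∑<-split x y _)
  (cong (runTail u x r +_) (∑<-cong y (λ i _ → cong (λ k → [ r ≤ᵇ k ]) (sym (+-assoc u x i)))))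

runTail-rank0 : ∀ u len → runTail u len 0 ≡ len
runTail-rank0 u len = trans (∑<-const len 1) (*-identityʳ len)

runTail-past : ∀ u len → runTail u len (u + len) ≡ 0
runTail-past u len = ∑<-zero len (λ i i<len → [≤ᵇ]≡0 (+-monoʳ-< u i<len))

runTail-reaching : ∀ u len {r} → r ≤ u + len → 0 < runTail u (suc len) r
runTail-reaching u len {r} r≤ = begin-strict
  0                             <⟨ z<s ⟩
  1                             ≡⟨ [≤ᵇ]≡1 r≤ ⟨
  [ r ≤ᵇ u + len ]              ≤⟨ m≤n+m _ (runTail u len r) ⟩
  runTail u len r + [ r ≤ᵇ u + len ] ≡⟨ ∑<-last len _ ⟨
  runTail u (suc len) r         ∎
  where open ≤-Reasoning

runTail-gap : ∀ {u L} t → u < L → 0 < t → runTail u t (u + t) < runTail L t (u + t)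
runTail-gap {u} {L} (suc t) u<L _ = subst (_< runTail L (suc t) (u + suc t)) (sym (runTail-past u (suc t)))
  (runTail-reaching L t (subst (_≤ L + t) (sym (+-suc u t)) (+-monoˡ-≤ t u<L)))

-- Regions of ℕ × ℕ

Region : Set
Region = ℕ → ℕ → Bool

regionTail : Region → ℕ → ℕ → ℕ
regionTail D r N = ∑< N (λ a → ∑< N (λ b → [ D a b ∧ (r ≤ᵇ a + b) ]))

IsDown : Region → Set
IsDown D = ∀ {a b a′ b′} → a′ ≤ a → b′ ≤ b → D a b ≡ true → D a′ b′ ≡ true

Within : Region → ℕ → ℕ → Set
Within D X Y = ∀ {a b} → D a b ≡ true → a < X × b < Y

module _ {D : Region} {X Y : ℕ} (D⊆X×Y : Within D X Y) where

  Within-col : ∀ {a b} → X ≤ a → D a b ≡ false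
  Within-col X≤a = ¬T⇒≡false (λ t → <⇒≱ (proj₁ (D⊆X×Y (T⇒≡true t))) X≤a)

  Within-row : ∀ {a b} → Y ≤ b → D a b ≡ false
  Within-row Y≤b = ¬T⇒≡false (λ t → <⇒≱ (proj₂ (D⊆X×Y (T⇒≡true t))) Y≤b)

  Within-mono : ∀ {X′ Y′} → X ≤ X′ → Y ≤ Y′ → Within D X′ Y′
  Within-mono X≤X′ Y≤Y′ Dab = let a<X , b<Y = D⊆X×Y Dab in <-≤-trans a<X X≤X′ , <-≤-trans b<Y Y≤Y′

  regionTail-within : ∀ {N} r → X ≤ N → Y ≤ N
                    → regionTail D r N ≡ ∑< X (λ a → ∑< Y (λ b → [ D a b ∧ (r ≤ᵇ a + b) ]))
  regionTail-within {N} r X≤N Y≤N =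
    ∑<-prefix X X≤N (λ a _ → ∑<-prefix Y Y≤N (λ _ _ → refl) (λ b Y≤b _ → outside (Within-row Y≤b)))
                    (λ a X≤a _ → ∑<-zero N (λ b _ → outside (Within-col X≤a)))
    where
      outside : ∀ {a b} → D a b ≡ false → [ D a b ∧ (r ≤ᵇ a + b) ] ≡ 0
      outside {a} {b} Dab≡false = cong (λ d → [ d ∧ (r ≤ᵇ a + b) ]) Dab≡false

  regionTail-≤ : ∀ {N} r → X ≤ N → Y ≤ N → regionTail D r N ≤ X * Y
  regionTail-≤ r X≤N Y≤N = subst (_≤ X * Y) (sym (regionTail-within r X≤N Y≤N))
    (∑<-≤-const X Y (λ a _ → subst (∑< Y (λ b → [ D a b ∧ (r ≤ᵇ a + b) ]) ≤_) (*-identityʳ Y)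
      (∑<-≤-const Y 1 (λ b _ → [∧]≤1 (D a b) (r ≤ᵇ a + b)))))
    where
      [∧]≤1 : ∀ b c → [ b ∧ c ] ≤ 1
      [∧]≤1 true true = ≤-refl
      [∧]≤1 true false = z≤n
      [∧]≤1 false c = z≤n

regionTail-grow : ∀ {D N} → Within D N N → ∀ r → regionTail D r (suc N) ≡ regionTail D r N
regionTail-grow {N = N} D⊆N×N r =
  trans (regionTail-within D⊆N×N r (n≤1+n N) (n≤1+n N)) (sym (regionTail-within D⊆N×N r ≤-refl ≤-refl))

regionTail-cong : ∀ {D E} → (∀ a b → D a b ≡ E a b) → ∀ r N → regionTail D r N ≡ regionTail E r N
regionTail-cong D≡E r N = ∑<-cong N (λ a _ → ∑<-cong N (λ b _ → cong (λ d → [ d ∧ (r ≤ᵇ a + b) ]) (D≡E a b)))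

transpose : Region → Region
transpose D a b = D b a

regionTail-transpose : ∀ D r N → regionTail (transpose D) r N ≡ regionTail D r N
regionTail-transpose D r N = trans (∑<-swap N N _)
  (∑<-cong N (λ a _ → ∑<-cong N (λ b _ → cong (λ x → [ D a b ∧ (r ≤ᵇ x) ]) (+-comm b a))))

IsDown-transpose : ∀ {D} → IsDown D → IsDown (transpose D)
IsDown-transpose D-down a′≤a b′≤b = D-down b′≤b a′≤a

Within-transpose : ∀ {D X Y} → Within D X Y → Within (transpose D) Y X
Within-transpose D⊆ inside = let b<X , a<Y = D⊆ inside in a<Y , b<X

dropBottomRow : Region → Region
dropBottomRow D a b = D a (suc b)

IsDown-dropBottomRow : ∀ {D} → IsDown D → IsDown (dropBottomRow D)
IsDown-dropBottomRow D-down a′≤a b′≤b = D-down a′≤a (s≤s b′≤b)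

Within-dropBottomRow : ∀ {D X Y} → Within D X (suc Y) → Within (dropBottomRow D) X Y
Within-dropBottomRow D⊆ inside = let a<X , b<Y = D⊆ inside in a<X , s<s⁻¹ b<Y

regionTail-peelFullRow : ∀ {D N} → (∀ a → a < suc N → D a 0 ≡ true) → (∀ a → D a (suc N) ≡ false)
  → ∀ r → regionTail D r (suc N) ≡ runTail 0 (suc N) r + regionTail (dropBottomRow D) (r ∸ 1) (suc N)
regionTail-peelFullRow {D} {N} bottom-full above-empty r = begin
  regionTail D r (suc N)
    ≡⟨ ∑<-+ (suc N) bottomCell (λ a → ∑< N (upperCell a)) ⟩
  ∑< (suc N) bottomCell + ∑< (suc N) (λ a → ∑< N (upperCell a))
    ≡⟨ cong₂ _+_ (∑<-cong (suc N) bottom) (∑<-cong (suc N) shifted) ⟩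
  runTail 0 (suc N) r + regionTail (dropBottomRow D) (r ∸ 1) (suc N) ∎
  where
    open ≡-Reasoning
    bottomCell : ℕ → ℕ
    bottomCell a = [ D a 0 ∧ (r ≤ᵇ a + 0) ]
    upperCell droppedCell : ℕ → ℕ → ℕ
    upperCell a b = [ D a (suc b) ∧ (r ≤ᵇ a + suc b) ]
    droppedCell a b = [ D a (suc b) ∧ (r ∸ 1 ≤ᵇ a + b) ]
    bottom : ∀ a → a < suc N → bottomCell a ≡ [ r ≤ᵇ a ]
    bottom a a<N rewrite bottom-full a a<N | +-identityʳ a = refl
    shifted : ∀ a → a < suc N → ∑< N (upperCell a) ≡ ∑< (suc N) (droppedCell a)
    shifted a _ = begin
      ∑< N (upperCell a)
        ≡⟨ ∑<-cong N (λ b _ → cong (λ c → [ D a (suc b) ∧ c ]) (trans (cong (r ≤ᵇ_) (+-suc a b)) (≤ᵇ-suc r (a + b)))) ⟩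
      ∑< N (droppedCell a)                       ≡⟨ +-identityʳ _ ⟨
      ∑< N (droppedCell a) + 0
        ≡⟨ cong (λ d → ∑< N (droppedCell a) + [ d ∧ (r ∸ 1 ≤ᵇ a + N) ]) (above-empty a) ⟨
      ∑< N (droppedCell a) + droppedCell a N     ≡⟨ ∑<-last N (droppedCell a) ⟨
      ∑< (suc N) (droppedCell a) ∎

Within-missingCorner : ∀ {D X Y c} → IsDown D → D c 0 ≡ false → Within D X Y → Within D c Y
Within-missingCorner {c = c} D-down corner-out D⊆ {a} inside with c ≤? a
... | no c≰a = ≰⇒> c≰a , proj₂ (D⊆ inside)
... | yes c≤a with trans (sym corner-out) (D-down c≤a z≤n inside)
...   | ()

-- The first m cells when the rows {a < L} × {b} are filled for b = 0, 1, …; filled (suc n) m is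
-- the C-segment of size m and transpose (filled n m) the L-segment.
filled : ℕ → ℕ → Region
filled L m a b = (a <ᵇ L) ∧ (b * L + a <ᵇ m)

filled-within : ∀ {L m Y} → m ≤ Y * L → Within (filled L m) L Y
filled-within {L} {m} {Y} m≤YL {a} {b} inside =
  let a<L , cell<m = ∧-true inside
  in <ᵇ⇒< a L (≡true⇒T a<L) , b<Y (<ᵇ⇒< (b * L + a) m (≡true⇒T cell<m))
  where
    b<Y : b * L + a < m → b < Y
    b<Y cell<m with Y ≤? b
    ... | no Y≰b = ≰⇒> Y≰b
    ... | yes Y≤b = ⊥-elim (<⇒≱ cell<m (≤-trans m≤YL (≤-trans (*-monoˡ-≤ L Y≤b) (m≤m+n (b * L) a))))

filled-down : ∀ {L m} → IsDown (filled L m)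
filled-down {L} {m} {a} {b} {a′} {b′} a′≤a b′≤b inside =
  cong₂ _∧_ (<ᵇ-true (≤-<-trans a′≤a a<L)) (<ᵇ-true (≤-<-trans (+-mono-≤ (*-monoˡ-≤ L b′≤b) a′≤a) cell<m))
  where
    a<L : a < L
    a<L = <ᵇ⇒< a L (≡true⇒T (proj₁ (∧-true inside)))
    cell<m : b * L + a < m
    cell<m = <ᵇ⇒< (b * L + a) m (≡true⇒T (proj₂ (∧-true inside)))

rowsTail : ℕ → ℕ → ℕ → ℕ
rowsTail q L r = ∑< q (λ b → runTail b L r)

rowsTail-suc : ∀ q L r → rowsTail q (suc L) r ≡ rowsTail q L r + runTail L q r
rowsTail-suc q L r = trans (∑<-cong q (λ b _ → ∑<-last L _))
  (trans (∑<-+ q (λ b → runTail b L r) _)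
         (cong (rowsTail q L r +_) (∑<-cong q (λ b _ → cong (λ k → [ r ≤ᵇ k ]) (+-comm b L)))))

filled-row : ∀ {L N m} b k r → k ≤ L → L ≤ N
  → (∀ a → a < k → b * L + a < m) → (∀ a → k ≤ a → a < L → m ≤ b * L + a)
  → ∑< N (λ a → [ filled L m a b ∧ (r ≤ᵇ a + b) ]) ≡ runTail b k r
filled-row {L} {N} {m} b k r k≤L L≤N inside outside = ∑<-prefix k (≤-trans k≤L L≤N) taken skipped
  where
    taken : ∀ a → a < k → [ filled L m a b ∧ (r ≤ᵇ a + b) ] ≡ [ r ≤ᵇ b + a ]
    taken a a<k rewrite <ᵇ-true (<-≤-trans a<k k≤L) | <ᵇ-true (inside a a<k) | +-comm a b = refl
    skipped : ∀ a → k ≤ a → a < N → [ filled L m a b ∧ (r ≤ᵇ a + b) ] ≡ 0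
    skipped a k≤a _ with a <? L
    ... | yes a<L rewrite <ᵇ-true a<L | <ᵇ-false (outside a k≤a a<L) = refl
    ... | no a≮L rewrite <ᵇ-false (≮⇒≥ a≮L) = refl

before-row : ∀ {L q s b} → s ≤ L → q < b → ∀ a → q * L + s ≤ b * L + a
before-row {L} {q} {s} {b} s≤L q<b a = begin
  q * L + s  ≤⟨ +-monoʳ-≤ (q * L) s≤L ⟩
  q * L + L  ≡⟨ +-comm (q * L) L ⟩
  suc q * L  ≤⟨ *-monoˡ-≤ L q<b ⟩
  b * L      ≤⟨ m≤m+n _ a ⟩
  b * L + a  ∎
  where open ≤-Reasoning

filled-tail : ∀ {L N} q s r → s ≤ L → L ≤ N → q < N
  → regionTail (filled L (q * L + s)) r N ≡ rowsTail q L r + runTail q s r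
filled-tail {L} {N} q s r s≤L L≤N q<N with m≤n⇒∃[o]m+o≡n q<N
... | d , refl = begin
  regionTail (filled L m) r N
    ≡⟨ ∑<-swap N N (λ a b → [ filled L m a b ∧ (r ≤ᵇ a + b) ]) ⟩
  ∑< N row
    ≡⟨ ∑<-split (suc q) d row ⟩
  ∑< (suc q) row + ∑< d (λ i → row (suc q + i))
    ≡⟨ cong (_+ ∑< d (λ i → row (suc q + i))) (∑<-last q row) ⟩
  ∑< q row + row q + ∑< d (λ i → row (suc q + i))
    ≡⟨ cong₂ _+_ (cong₂ _+_ (∑<-cong q full) partial) (∑<-zero d empty) ⟩
  rowsTail q L r + runTail q s r + 0
    ≡⟨ +-identityʳ _ ⟩
  rowsTail q L r + runTail q s r ∎
  where
    open ≡-Reasoning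
    m : ℕ
    m = q * L + s
    row : ℕ → ℕ
    row b = ∑< N (λ a → [ filled L m a b ∧ (r ≤ᵇ a + b) ])
    full : ∀ b → b < q → row b ≡ runTail b L r
    full b b<q = filled-row b L r ≤-refl L≤N
      (λ a a<L → <-≤-trans (+-monoʳ-< (b * L) a<L)
                   (≤-trans (subst (_≤ q * L) (+-comm L (b * L)) (*-monoˡ-≤ L b<q)) (m≤m+n (q * L) s)))
      (λ a L≤a a<L → ⊥-elim (<⇒≱ a<L L≤a))
    partial : row q ≡ runTail q s r
    partial = filled-row q s r s≤L L≤N
      (λ a a<s → +-monoʳ-< (q * L) a<s)
      (λ a s≤a _ → +-monoʳ-≤ (q * L) s≤a)
    empty : ∀ i → i < d → row (suc q + i) ≡ 0
    empty i _ = filled-row (suc q + i) 0 r z≤n L≤N (λ a ()) (λ a _ _ → before-row s≤L (s≤s (m≤m+n q i)) a)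

filled-size : ∀ {L N} m .{{_ : NonZero L}} → L ≤ N → m < N * L → regionTail (filled L m) 0 N ≡ m
filled-size {L} {N} m L≤N m<NL with quotRem m L
... | q , s , s<L , refl = begin
  regionTail (filled L (q * L + s)) 0 N  ≡⟨ filled-tail q s 0 (<⇒≤ s<L) L≤N q<N ⟩
  rowsTail q L 0 + runTail q s 0
    ≡⟨ cong₂ _+_ (trans (∑<-cong q (λ b _ → runTail-rank0 b L)) (∑<-const q L)) (runTail-rank0 q s) ⟩
  q * L + s ∎
  where
    open ≡-Reasoning
    q<N : q < N
    q<N = *-cancelʳ-< L q N (≤-<-trans (m≤m+n (q * L) s) m<NL)

filled-dropBottomRow : ∀ L m a b → dropBottomRow (filled L (L + m)) a b ≡ filled L m a b
filled-dropBottomRow L m a b = cong ((a <ᵇ L) ∧_) (trans (cong (_<ᵇ L + m) (+-assoc L (b * L) a)) (<ᵇ-cancelˡ L))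

filled-peelRow : ∀ {N} m → suc N + m ≤ suc N * suc N → ∀ r
  → regionTail (filled (suc N) (suc N + m)) r (suc N)
  ≡ runTail 0 (suc N) r + regionTail (filled (suc N) m) (r ∸ 1) (suc N)
filled-peelRow {N} m bound r = trans
  (regionTail-peelFullRow {filled (suc N) (suc N + m)} bottom-full
     (λ a → Within-row (filled-within {suc N} {Y = suc N} bound) ≤-refl) r)
  (cong (runTail 0 (suc N) r +_) (regionTail-cong (filled-dropBottomRow (suc N) m) (r ∸ 1) (suc N)))
  where
    bottom-full : ∀ a → a < suc N → filled (suc N) (suc N + m) a 0 ≡ true
    bottom-full a a<L = cong₂ _∧_ (<ᵇ-true a<L) (<ᵇ-true (<-≤-trans a<L (m≤m+n (suc N) m)))

widen-exchange-≤ : ∀ {L q s} r → q ≤ s → s ≤ L →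
  ∃[ c ] regionTail (filled L (q * L + s)) r (suc L) ≡ c + runTail s q r
       × regionTail (filled (suc L) (q * L + s)) r (suc L) ≡ c + runTail L q r
widen-exchange-≤ {L} {q} r q≤s s≤L with m≤n⇒∃[o]m+o≡n q≤s
... | e , refl = rowsTail q L r + runTail q e r , narrow , wide
  where
    open ≡-Reasoning
    q<1+L : q < suc L
    q<1+L = s≤s (≤-trans (m≤m+n q e) s≤L)
    regroup : ∀ q L e → q * L + (q + e) ≡ q * suc L + e
    regroup = solve-∀
    narrow : regionTail (filled L (q * L + (q + e))) r (suc L) ≡ rowsTail q L r + runTail q e r + runTail (q + e) q r
    narrow = begin
      regionTail (filled L (q * L + (q + e))) r (suc L)
        ≡⟨ filled-tail q (q + e) r s≤L (n≤1+n L) q<1+L ⟩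
      rowsTail q L r + runTail q (q + e) r
        ≡⟨ cong (λ k → rowsTail q L r + runTail q k r) (+-comm q e) ⟩
      rowsTail q L r + runTail q (e + q) r
        ≡⟨ cong (rowsTail q L r +_) (runTail-split q e q r) ⟩
      rowsTail q L r + (runTail q e r + runTail (q + e) q r)
        ≡⟨ +-assoc (rowsTail q L r) (runTail q e r) (runTail (q + e) q r) ⟨
      rowsTail q L r + runTail q e r + runTail (q + e) q r ∎
    wide : regionTail (filled (suc L) (q * L + (q + e))) r (suc L) ≡ rowsTail q L r + runTail q e r + runTail L q r
    wide = begin
      regionTail (filled (suc L) (q * L + (q + e))) r (suc L)
        ≡⟨ cong (λ m → regionTail (filled (suc L) m) r (suc L)) (regroup q L e) ⟩
      regionTail (filled (suc L) (q * suc L + e)) r (suc L)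
        ≡⟨ filled-tail q e r (≤-trans (m≤n+m e q) (≤-trans s≤L (n≤1+n L))) ≤-refl q<1+L ⟩
      rowsTail q (suc L) r + runTail q e r
        ≡⟨ cong (_+ runTail q e r) (rowsTail-suc q L r) ⟩
      rowsTail q L r + runTail L q r + runTail q e r
        ≡⟨ ℕ+.xy∙z≈xz∙y (rowsTail q L r) (runTail L q r) (runTail q e r) ⟩
      rowsTail q L r + runTail q e r + runTail L q r ∎

module WidenExchange> (s e g r : ℕ) where

  p L f+s : ℕ
  p = s + e
  L = suc p + g
  f+s = suc g + s

  common : ℕ
  common = rowsTail p L r + runTail p f+s r + runTail (L + s) e r

  private
    L-split : L ≡ f+s + e
    L-split = identity s e g
      where
        identity : ∀ s e g → suc (s + e) + g ≡ suc g + s + e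
        identity = solve-∀
    L+s : p + f+s ≡ L + s
    L+s = identity s e g
      where
        identity : ∀ s e g → s + e + (suc g + s) ≡ suc (s + e) + g + s
        identity = solve-∀
    m-split : suc p * L + s ≡ p * suc L + f+s
    m-split = identity s e g
      where
        identity : ∀ s e g → suc (s + e) * (suc (s + e) + g) + s ≡ (s + e) * suc (suc (s + e) + g) + (suc g + s)
        identity = solve-∀
    shuffle : ∀ a b c d → a + (b + c) + d ≡ a + d + c + b
    shuffle = solve-∀
    open ≡-Reasoning

  narrow : regionTail (filled L (suc p * L + s)) r (suc L) ≡ common + runTail (suc p) s r
  narrow = begin
    regionTail (filled L (suc p * L + s)) r (suc L)
      ≡⟨ filled-tail (suc p) s r (≤-trans (m≤m+n s e) (≤-trans (n≤1+n p) (m≤m+n (suc p) g))) (n≤1+n L)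
                     (s≤s (m≤m+n (suc p) g)) ⟩
    rowsTail (suc p) L r + runTail (suc p) s r
      ≡⟨ cong (_+ runTail (suc p) s r) (∑<-last p _) ⟩
    rowsTail p L r + runTail p L r + runTail (suc p) s r
      ≡⟨ cong (λ k → rowsTail p L r + runTail p k r + runTail (suc p) s r) L-split ⟩
    rowsTail p L r + runTail p (f+s + e) r + runTail (suc p) s r
      ≡⟨ cong (λ k → rowsTail p L r + k + runTail (suc p) s r) (runTail-split p f+s e r) ⟩
    rowsTail p L r + (runTail p f+s r + runTail (p + f+s) e r) + runTail (suc p) s r
      ≡⟨ cong (λ u → rowsTail p L r + (runTail p f+s r + runTail u e r) + runTail (suc p) s r) L+s ⟩
    rowsTail p L r + (runTail p f+s r + runTail (L + s) e r) + runTail (suc p) s r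
      ≡⟨ cong (_+ runTail (suc p) s r) (+-assoc (rowsTail p L r) _ _) ⟨
    common + runTail (suc p) s r ∎

  wide : regionTail (filled (suc L) (suc p * L + s)) r (suc L) ≡ common + runTail L s r
  wide = begin
    regionTail (filled (suc L) (suc p * L + s)) r (suc L)
      ≡⟨ cong (λ m → regionTail (filled (suc L) m) r (suc L)) m-split ⟩
    regionTail (filled (suc L) (p * suc L + f+s)) r (suc L)
      ≡⟨ filled-tail p f+s r (≤-trans (subst (f+s ≤_) (sym L-split) (m≤m+n f+s e)) (n≤1+n L)) ≤-refl
                     (s≤s (≤-trans (n≤1+n p) (m≤m+n (suc p) g))) ⟩
    rowsTail p (suc L) r + runTail p f+s r
      ≡⟨ cong (_+ runTail p f+s r) (rowsTail-suc p L r) ⟩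
    rowsTail p L r + runTail L p r + runTail p f+s r
      ≡⟨ cong (λ k → rowsTail p L r + k + runTail p f+s r) (runTail-split L s e r) ⟩
    rowsTail p L r + (runTail L s r + runTail (L + s) e r) + runTail p f+s r
      ≡⟨ shuffle (rowsTail p L r) (runTail L s r) (runTail (L + s) e r) (runTail p f+s r) ⟩
    common + runTail L s r ∎

widen-exchange-> : ∀ {L q s} r → s < q → q ≤ L →
  ∃[ c ] regionTail (filled L (q * L + s)) r (suc L) ≡ c + runTail q s r
       × regionTail (filled (suc L) (q * L + s)) r (suc L) ≡ c + runTail L s r
widen-exchange-> {s = s} r s<q q≤L with m≤n⇒∃[o]m+o≡n s<q
... | e , refl with m≤n⇒∃[o]m+o≡n q≤L
...   | g , refl = common , narrow , wide
  where open WidenExchange> s e g r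

widen-exchange : ∀ {L} q s r → q ≤ L → s ≤ L →
  ∃[ c ] regionTail (filled L (q * L + s)) r (suc L) ≡ c + runTail (q ⊔ s) (q ⊓ s) r
       × regionTail (filled (suc L) (q * L + s)) r (suc L) ≡ c + runTail L (q ⊓ s) r
widen-exchange q s r q≤L s≤L with q ≤? s
... | yes q≤s rewrite m≤n⇒m⊔n≡n q≤s | m≤n⇒m⊓n≡m q≤s = widen-exchange-≤ r q≤s s≤L
... | no q≰s rewrite m≥n⇒m⊔n≡m (<⇒≤ (≰⇒> q≰s)) | m≥n⇒m⊓n≡n (<⇒≤ (≰⇒> q≰s)) =
  widen-exchange-> r (≰⇒> q≰s) q≤L

widen-dominates : ∀ L m → m ≤ L * L
  → ∀ r → regionTail (filled L m) r (suc L) ≤ regionTail (filled (suc L) m) r (suc L)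
widen-dominates zero m _ r = z≤n
widen-dominates L@(suc _) m m≤LL r with quotRem m L
... | q , s , s<L , refl =
  let c , narrow , wide = widen-exchange q s r q≤L (<⇒≤ s<L)
  in subst₂ _≤_ (sym narrow) (sym wide) (+-monoʳ-≤ c (runTail-mono (q ⊓ s) r (⊔-lub q≤L (<⇒≤ s<L))))
  where
    q≤L : q ≤ L
    q≤L = *-cancelʳ-≤ q L L (≤-trans (m≤m+n (q * L) s) m≤LL)

widen-preserves : ∀ {L} q s → q ≤ L → s ≤ L → q ⊓ s ≡ 0 ⊎ q ⊔ s ≡ L → ∀ r
  → regionTail (filled (suc L) (q * L + s)) r (suc L) ≡ regionTail (filled L (q * L + s)) r (suc L)
widen-preserves {L} q s q≤L s≤L degenerate r =
  let c , narrow , wide = widen-exchange q s r q≤L s≤L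
  in trans wide (trans (cong (c +_) (same-runs degenerate)) (sym narrow))
  where
    same-runs : q ⊓ s ≡ 0 ⊎ q ⊔ s ≡ L → runTail L (q ⊓ s) r ≡ runTail (q ⊔ s) (q ⊓ s) r
    same-runs (inj₁ q⊓s≡0) rewrite q⊓s≡0 = refl
    same-runs (inj₂ q⊔s≡L) rewrite q⊔s≡L = refl

widen-strict : ∀ {L} q s → 0 < q ⊓ s → q ⊔ s < L →
  ∃[ r ] regionTail (filled L (q * L + s)) r (suc L) < regionTail (filled (suc L) (q * L + s)) r (suc L)
widen-strict q s 0<q⊓s q⊔s<L =
  let c , narrow , wide = widen-exchange q s r (<⇒≤ (m⊔n<o⇒m<o q s q⊔s<L)) (<⇒≤ (m⊔n<o⇒n<o q s q⊔s<L))
  in r , subst₂ _<_ (sym narrow) (sym wide) (+-monoʳ-< c (runTail-gap (q ⊓ s) q⊔s<L 0<q⊓s))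
  where
    r : ℕ
    r = q ⊔ s + q ⊓ s

-- Compression of downsets

-- Induction on the box: a full bottom row is peeled off; otherwise D avoids the column L - 1, and
-- it is transposed if it may still have L rows, or else lies in the square box of side L - 1,
-- after which widen-dominates lengthens the rows.
compress : ∀ L k → k ≤ L → (D : Region) → IsDown D → Within D L k
  → ∀ r → regionTail D r L ≤ regionTail (filled L (regionTail D 0 L)) r L
compress L zero _ D _ D⊆ r = ≤-trans (regionTail-≤ D⊆ r ≤-refl z≤n) (≤-trans (≤-reflexive (*-zeroʳ L)) z≤n)
compress L@(suc L′) (suc k) k<L D D-down D⊆ r with D L′ 0 in corner
... | true = begin
  regionTail D r L                                       ≡⟨ peel r ⟩
  runTail 0 L r + regionTail D↑ (r ∸ 1) L                ≤⟨ +-monoʳ-≤ (runTail 0 L r) (lower (r ∸ 1)) ⟩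
  runTail 0 L r + regionTail (filled L m′) (r ∸ 1) L      ≡⟨ filled-peelRow {L′} m′ (subst (_≤ L * L) D-size bound) r ⟨
  regionTail (filled L (L + m′)) r L                     ≡⟨ cong (λ m → regionTail (filled L m) r L) D-size ⟨
  regionTail (filled L (regionTail D 0 L)) r L ∎
  where
    open ≤-Reasoning
    D↑ : Region
    D↑ = dropBottomRow D
    m′ : ℕ
    m′ = regionTail D↑ 0 L
    peel : ∀ r → regionTail D r L ≡ runTail 0 L r + regionTail D↑ (r ∸ 1) L
    peel = regionTail-peelFullRow {D} (λ a a<L → D-down (s≤s⁻¹ a<L) z≤n corner) (λ a → Within-row D⊆ {a} k<L)
    lower : ∀ r → regionTail D↑ r L ≤ regionTail (filled L m′) r L
    lower = compress L k (<⇒≤ k<L) D↑ (IsDown-dropBottomRow D-down) (Within-dropBottomRow D⊆)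
    D-size : regionTail D 0 L ≡ L + m′
    D-size = trans (peel 0) (cong (_+ m′) (runTail-rank0 0 L))
    bound : regionTail D 0 L ≤ L * L
    bound = ≤-trans (regionTail-≤ D⊆ 0 ≤-refl k<L) (*-monoʳ-≤ L k<L)
... | false with k ≟ L′
...   | yes refl = subst₂ _≤_ (regionTail-transpose D r L)
                     (cong (λ m → regionTail (filled L m) r L) (regionTail-transpose D 0 L))
                     (compress L k (n≤1+n k) (transpose D) (IsDown-transpose D-down)
                       (Within-transpose (Within-missingCorner D-down corner D⊆)) r)
...   | no k≢L′ = begin
  regionTail D r L                  ≡⟨ regionTail-grow D⊆L′ r ⟩
  regionTail D r L′                 ≤⟨ compress L′ (suc k) k<L′ D D-down D⊆L′×k r ⟩
  regionTail (filled L′ m) r L′      ≡⟨ regionTail-grow (filled-within {Y = L′} bound) r ⟨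
  regionTail (filled L′ m) r L       ≤⟨ widen-dominates L′ m bound r ⟩
  regionTail (filled L m) r L        ≡⟨ cong (λ m → regionTail (filled L m) r L) (regionTail-grow D⊆L′ 0) ⟨
  regionTail (filled L (regionTail D 0 L)) r L ∎
  where
    open ≤-Reasoning
    k<L′ : suc k ≤ L′
    k<L′ = ≤∧≢⇒< (s≤s⁻¹ k<L) k≢L′
    D⊆L′×k : Within D L′ (suc k)
    D⊆L′×k = Within-missingCorner D-down corner D⊆
    D⊆L′ : Within D L′ L′
    D⊆L′ = Within-mono D⊆L′×k ≤-refl k<L′
    m : ℕ
    m = regionTail D 0 L′
    bound : m ≤ L′ * L′
    bound = ≤-trans (regionTail-≤ D⊆L′×k 0 ≤-refl k<L′) (*-monoʳ-≤ L′ k<L′)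

-- Subsets of the grid as regions

sum-allFin : ∀ n (h : ℕ → ℕ) → sum (map (λ i → h (toℕ i)) (allFin n)) ≡ ∑< n h
sum-allFin n h = trans (cong sum (map-tabulate {n = n} id (λ i → h (toℕ i)))) (sum-tabulate n h)
  where
    sum-tabulate : ∀ n (h : ℕ → ℕ) → sum (tabulate {n = n} (λ i → h (toℕ i))) ≡ ∑< n h
    sum-tabulate zero h = refl
    sum-tabulate (suc n) h = cong (h 0 +_) (sum-tabulate n (λ k → h (suc k)))

sum-cartesianProduct : ∀ {A B : Set} (f : A × B → ℕ) xs ys
  → sum (map f (cartesianProduct xs ys)) ≡ sum (map (λ x → sum (map (λ y → f (x , y)) ys)) xs)
sum-cartesianProduct f [] ys = refl
sum-cartesianProduct f (x ∷ xs) ys = begin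
  sum (map f (map (x ,_) ys ++ cartesianProduct xs ys))
    ≡⟨ cong sum (map-++ f (map (x ,_) ys) _) ⟩
  sum (map f (map (x ,_) ys) ++ map f (cartesianProduct xs ys))
    ≡⟨ sum-++ (map f (map (x ,_) ys)) _ ⟩
  sum (map f (map (x ,_) ys)) + sum (map f (cartesianProduct xs ys))
    ≡⟨ cong₂ _+_ (cong sum (sym (map-∘ ys))) (sum-cartesianProduct f xs ys) ⟩
  sum (map (λ y → f (x , y)) ys) + sum (map (λ x → sum (map (λ y → f (x , y)) ys)) xs) ∎
  where open ≡-Reasoning

sum-points : ∀ {ℓ₁ ℓ₂} (f : Point ℓ₁ ℓ₂ → ℕ) (F : ℕ → ℕ → ℕ) → (∀ i j → f (i , j) ≡ F (toℕ i) (toℕ j))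
  → sum (map f (points ℓ₁ ℓ₂)) ≡ ∑< ℓ₁ (λ a → ∑< ℓ₂ (F a))
sum-points {ℓ₁} {ℓ₂} f F f≡F = trans (sum-cartesianProduct f (allFin ℓ₁) (allFin ℓ₂))
  (trans (cong sum (map-cong (λ i → trans (cong sum (map-cong (f≡F i) (allFin ℓ₂))) (sum-allFin ℓ₂ (F (toℕ i))))
                             (allFin ℓ₁)))
         (sum-allFin ℓ₁ (λ a → ∑< ℓ₂ (F a))))

length-filter : ∀ {A : Set} (P : A → Bool) xs → length (filter (λ x → T? (P x)) xs) ≡ sum (map (λ x → [ P x ]) xs)
length-filter P [] = refl
length-filter P (x ∷ xs) with P x
... | true = cong suc (length-filter P xs)
... | false = length-filter P xs

rankTail-filter : ∀ {A : Set} (rk : A → ℕ) (S : A → Bool) r xs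
  → RankTail.rankTail rk r (filter (λ x → T? (S x)) xs) ≡ sum (map (λ x → [ S x ∧ (r ≤ᵇ rk x) ]) xs)
rankTail-filter rk S r [] = refl
rankTail-filter rk S r (x ∷ xs) with S x
... | true = cong ([ r ≤ᵇ rk x ] +_) (rankTail-filter rk S r xs)
... | false = rankTail-filter rk S r xs

module _ {ℓ₁ ℓ₂ : ℕ} where

  toRegion : SubsetM ℓ₁ ℓ₂ → Region
  toRegion S a b with a <? ℓ₁ | b <? ℓ₂
  ... | yes a<ℓ₁ | yes b<ℓ₂ = S (fromℕ< a<ℓ₁ , fromℕ< b<ℓ₂)
  ... | _ | _ = false

  fromRegion : Region → SubsetM ℓ₁ ℓ₂
  fromRegion D (i , j) = D (toℕ i) (toℕ j)

  toRegion-fromℕ< : ∀ S {a b} (a<ℓ₁ : a < ℓ₁) (b<ℓ₂ : b < ℓ₂) → toRegion S a b ≡ S (fromℕ< a<ℓ₁ , fromℕ< b<ℓ₂)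
  toRegion-fromℕ< S {a} {b} a<ℓ₁ b<ℓ₂ with a <? ℓ₁ | b <? ℓ₂
  ... | yes _ | yes _ = refl
  ... | no a≮ | _ = ⊥-elim (a≮ a<ℓ₁)
  ... | yes _ | no b≮ = ⊥-elim (b≮ b<ℓ₂)

  toRegion-toℕ : ∀ S i j → toRegion S (toℕ i) (toℕ j) ≡ S (i , j)
  toRegion-toℕ S i j = trans (toRegion-fromℕ< S (toℕ<n i) (toℕ<n j))
                             (cong₂ (λ i j → S (i , j)) (fromℕ<-toℕ i (toℕ<n i)) (fromℕ<-toℕ j (toℕ<n j)))

  toRegion-within : ∀ S → Within (toRegion S) ℓ₁ ℓ₂
  toRegion-within S {a} {b} inside with a <? ℓ₁ | b <? ℓ₂
  ... | yes a<ℓ₁ | yes b<ℓ₂ = a<ℓ₁ , b<ℓ₂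
  toRegion-within S () | yes _ | no _
  toRegion-within S () | no _ | _

  toRegion-fromRegion : ∀ {D} → Within D ℓ₁ ℓ₂ → ∀ a b → toRegion (fromRegion D) a b ≡ D a b
  toRegion-fromRegion {D} D⊆ a b with a <? ℓ₁ | b <? ℓ₂
  ... | yes a<ℓ₁ | yes b<ℓ₂ = cong₂ D (toℕ-fromℕ< a<ℓ₁) (toℕ-fromℕ< b<ℓ₂)
  ... | no a≮ | _ = sym (Within-col D⊆ (≮⇒≥ a≮))
  ... | yes _ | no b≮ = sym (Within-row D⊆ (≮⇒≥ b≮))

  toRegion-cong : ∀ {S S′ : SubsetM ℓ₁ ℓ₂} → (∀ p → S p ≡ S′ p) → ∀ a b → toRegion S a b ≡ toRegion S′ a b
  toRegion-cong S≗S′ a b with a <? ℓ₁ | b <? ℓ₂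
  ... | yes _ | yes _ = S≗S′ _
  ... | no _ | _ = refl
  ... | yes _ | no _ = refl

  toRegion-down : ∀ {S} → Downset S → IsDown (toRegion S)
  toRegion-down {S} S-down {a} {b} {a′} {b′} a′≤a b′≤b inside =
    let a<ℓ₁ , b<ℓ₂ = toRegion-within S inside
        a′<ℓ₁ = ≤-<-trans a′≤a a<ℓ₁
        b′<ℓ₂ = ≤-<-trans b′≤b b<ℓ₂
    in trans (toRegion-fromℕ< S a′<ℓ₁ b′<ℓ₂)
             (S-down _ _ (fromℕ<-≤ᵇ a′<ℓ₁ a<ℓ₁ a′≤a , fromℕ<-≤ᵇ b′<ℓ₂ b<ℓ₂ b′≤b)
                     (trans (sym (toRegion-fromℕ< S a<ℓ₁ b<ℓ₂)) inside))
    where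
      fromℕ<-≤ᵇ : ∀ {x x′ k} (x′<k : x′ < k) (x<k : x < k) → x′ ≤ x → T (toℕ (fromℕ< x′<k) ≤ᵇ toℕ (fromℕ< x<k))
      fromℕ<-≤ᵇ x′<k x<k x′≤x = ≤⇒≤ᵇ (subst₂ _≤_ (sym (toℕ-fromℕ< x′<k)) (sym (toℕ-fromℕ< x<k)) x′≤x)

  fromRegion-down : ∀ {D} → IsDown D → Downset (fromRegion D)
  fromRegion-down D-down (i′ , j′) (i , j) (i′≤i , j′≤j) = D-down (≤ᵇ⇒≤ _ _ i′≤i) (≤ᵇ⇒≤ _ _ j′≤j)

  rankTail-elemsOf : ∀ {N} (S : SubsetM ℓ₁ ℓ₂) r → ℓ₁ ≤ N → ℓ₂ ≤ N
    → RankTail.rankTail rank r (elemsOf S) ≡ regionTail (toRegion S) r N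
  rankTail-elemsOf {N} S r ℓ₁≤N ℓ₂≤N = begin
    RankTail.rankTail rank r (elemsOf S)
      ≡⟨ rankTail-filter rank S r (points ℓ₁ ℓ₂) ⟩
    sum (map (λ p → [ S p ∧ (r ≤ᵇ rank p) ]) (points ℓ₁ ℓ₂))
      ≡⟨ sum-points _ (λ a b → [ toRegion S a b ∧ (r ≤ᵇ a + b) ])
                     (λ i j → cong (λ d → [ d ∧ (r ≤ᵇ toℕ i + toℕ j) ]) (sym (toRegion-toℕ S i j))) ⟩
    ∑< ℓ₁ (λ a → ∑< ℓ₂ (λ b → [ toRegion S a b ∧ (r ≤ᵇ a + b) ]))
      ≡⟨ regionTail-within (toRegion-within S) r ℓ₁≤N ℓ₂≤N ⟨
    regionTail (toRegion S) r N ∎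
    where open ≡-Reasoning

  size≡regionTail : ∀ {N} (S : SubsetM ℓ₁ ℓ₂) → ℓ₁ ≤ N → ℓ₂ ≤ N → size S ≡ regionTail (toRegion S) 0 N
  size≡regionTail S ℓ₁≤N ℓ₂≤N = trans (sym (RankTail.rankTail-zero rank (elemsOf S))) (rankTail-elemsOf S 0 ℓ₁≤N ℓ₂≤N)

lexRank : ∀ {X Y a b} → a < X → b ≤ Y
  → ∑< X (λ a′ → ∑< Y (λ b′ → [ (a′ <ᵇ a) ∨ ((a′ ≡ᵇ a) ∧ (b′ <ᵇ b)) ])) ≡ a * Y + b
lexRank {X} {Y} {a} {b} a<X b≤Y with m≤n⇒∃[o]m+o≡n a<X
... | d , refl = begin
  ∑< (suc a + d) column                                ≡⟨ ∑<-split (suc a) d column ⟩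
  ∑< (suc a) column + ∑< d (λ i → column (suc a + i))  ≡⟨ cong (_+ ∑< d (λ i → column (suc a + i))) (∑<-last a column) ⟩
  ∑< a column + column a + ∑< d (λ i → column (suc a + i))
    ≡⟨ cong₂ _+_ (cong₂ _+_ (∑<-cong a before) own) (∑<-zero d after) ⟩
  ∑< a (λ _ → Y) + b + 0                                ≡⟨ +-identityʳ _ ⟩
  ∑< a (λ _ → Y) + b                                    ≡⟨ cong (_+ b) (∑<-const a Y) ⟩
  a * Y + b ∎
  where
    open ≡-Reasoning
    column : ℕ → ℕ
    column a′ = ∑< Y (λ b′ → [ (a′ <ᵇ a) ∨ ((a′ ≡ᵇ a) ∧ (b′ <ᵇ b)) ])
    before : ∀ a′ → a′ < a → column a′ ≡ Y
    before a′ a′<a rewrite <ᵇ-true a′<a = trans (∑<-const Y 1) (*-identityʳ Y)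
    own : column a ≡ b
    own rewrite <ᵇ-false {a} ≤-refl | ≡ᵇ-refl a = ∑<-[<ᵇ] b≤Y
    after : ∀ i → i < d → column (suc a + i) ≡ 0
    after i _ rewrite <ᵇ-false (≤-trans (n≤1+n a) (m≤m+n (suc a) i)) | ≡ᵇ-false (λ e → <⇒≢ (s≤s (m≤m+n a i)) (sym e))
      = ∑<-zero Y (λ _ _ → refl)

module _ {ℓ₁ ℓ₂ : ℕ} where

  below-L : ∀ (i : Fin ℓ₁) (j : Fin ℓ₂) → below _<L_ (i , j) ≡ toℕ i * ℓ₂ + toℕ j
  below-L i j = trans (length-filter (λ q → q <L (i , j)) (points ℓ₁ ℓ₂))
    (trans (sum-points {ℓ₁} {ℓ₂} _ (λ a′ b′ → [ (a′ <ᵇ toℕ i) ∨ ((a′ ≡ᵇ toℕ i) ∧ (b′ <ᵇ toℕ j)) ]) (λ _ _ → refl))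
           (lexRank (toℕ<n i) (<⇒≤ (toℕ<n j))))

  below-C : ∀ (i : Fin ℓ₁) (j : Fin ℓ₂) → below _<C_ (i , j) ≡ toℕ j * ℓ₁ + toℕ i
  below-C i j = trans (length-filter (λ q → q <C (i , j)) (points ℓ₁ ℓ₂))
    (trans (sum-points {ℓ₁} {ℓ₂} _ (λ a′ b′ → [ (b′ <ᵇ toℕ j) ∨ ((b′ ≡ᵇ toℕ j) ∧ (a′ <ᵇ toℕ i)) ]) (λ _ _ → refl))
    (trans (∑<-swap ℓ₁ ℓ₂ _)
           (lexRank (toℕ<n j) (<⇒≤ (toℕ<n i)))))

  initialSegment-pointwise : ∀ (_<o_ : Point ℓ₁ ℓ₂ → Point ℓ₁ ℓ₂ → Bool) {S m}
    → IsInitialSegment _<o_ S m → ∀ p → S p ≡ (below _<o_ p <ᵇ m)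
  initialSegment-pointwise _ segment p = T-ext (λ t → <⇒<ᵇ (Equivalence.to (segment p) (T⇒≡true t)))
                                             (λ t → ≡true⇒T (Equivalence.from (segment p) (<ᵇ⇒< _ _ t)))

  C-segment : ∀ {S : SubsetM ℓ₁ ℓ₂} {m} → IsInitialSegment _<C_ S m → ∀ p → S p ≡ fromRegion (filled ℓ₁ m) p
  C-segment {S} {m} segment (i , j) = trans (initialSegment-pointwise _<C_ segment (i , j))
    (trans (cong (_<ᵇ m) (below-C i j)) (cong (_∧ (toℕ j * ℓ₁ + toℕ i <ᵇ m)) (sym (<ᵇ-true (toℕ<n i)))))

  L-segment : ∀ {S : SubsetM ℓ₁ ℓ₂} {m} → IsInitialSegment _<L_ S m → ∀ p → S p ≡ fromRegion (transpose (filled ℓ₂ m)) p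
  L-segment {S} {m} segment (i , j) = trans (initialSegment-pointwise _<L_ segment (i , j))
    (trans (cong (_<ᵇ m) (below-L i j)) (cong (_∧ (toℕ i * ℓ₂ + toℕ j <ᵇ m)) (sym (<ᵇ-true (toℕ<n j)))))

-- Optimality of the initial segments

LOptimalSize : ℕ → ℕ → Set
LOptimalSize n m = m ≤ n ⊎ n * n ≤ m ⊎ ∃ λ k → m ≡ k * n

LOptimalSize⊎strictSplit : ∀ n m .{{_ : NonZero n}} →
  LOptimalSize n m ⊎ (∃[ q ] ∃[ s ] 0 < q ⊓ s × q ⊔ s < n × m ≡ q * n + s)
LOptimalSize⊎strictSplit n m with quotRem m n
... | q , zero , _ , refl = inj₁ (inj₂ (inj₂ (q , +-identityʳ (q * n))))
... | zero , s , s<n , refl = inj₁ (inj₁ (<⇒≤ s<n))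
... | suc q , suc s , s<n , refl with suc q <? n
...   | no q≮n = inj₁ (inj₂ (inj₁ (≤-trans (*-monoˡ-≤ n (≮⇒≥ q≮n)) (m≤m+n (suc q * n) (suc s)))))
...   | yes q<n = inj₂ (suc q , suc s , z<s , ⊔-lub q<n s<n , refl)

LOptimalSize⇒degenerateSplit : ∀ n m .{{_ : NonZero n}} → m ≤ n * suc n → LOptimalSize n m
  → ∃[ q ] ∃[ s ] q ≤ n × s ≤ n × m ≡ q * n + s × (q ⊓ s ≡ 0 ⊎ q ⊔ s ≡ n)
LOptimalSize⇒degenerateSplit n m _ (inj₁ m≤n) = 0 , m , z≤n , m≤n , refl , inj₁ refl
LOptimalSize⇒degenerateSplit n m m≤ (inj₂ (inj₁ nn≤m)) =
  n , m ∸ n * n , ≤-refl , s≤n , sym (m+[n∸m]≡n nn≤m) , inj₂ (m≥n⇒m⊔n≡m s≤n)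
  where
    s≤n : m ∸ n * n ≤ n
    s≤n = m≤n+o⇒m∸n≤o m (n * n) (subst (m ≤_) (trans (*-suc n n) (+-comm n (n * n))) m≤)
LOptimalSize⇒degenerateSplit n m _ (inj₂ (inj₂ (zero , refl))) = 0 , 0 , z≤n , z≤n , refl , inj₁ refl
LOptimalSize⇒degenerateSplit n m m≤ (inj₂ (inj₂ (suc k , refl))) =
  k , n , k≤n , ≤-refl , +-comm n (k * n) , inj₂ (m≤n⇒m⊔n≡n k≤n)
  where
    k≤n : k ≤ n
    k≤n = s≤s⁻¹ (*-cancelʳ-≤ (suc k) (suc n) n (subst (suc k * n ≤_) (*-comm n (suc n)) m≤))

module Optimality {n : ℕ} (wt : Weight (suc n) n) (increasing : RankIncreasing wt) (constant : RankConstant wt) where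

  open Majorization rank wt constant increasing using (weight-mono; weight-strict)

  tail : SubsetM (suc n) n → ℕ → ℕ
  tail S r = regionTail (toRegion S) r (suc n)

  private
    rankTail≡tail : ∀ S r → RankTail.rankTail rank r (elemsOf S) ≡ tail S r
    rankTail≡tail S r = rankTail-elemsOf S r ≤-refl (n≤1+n n)

  wtSet-mono : ∀ {B A} → size B ≡ size A → (∀ r → tail B r ≤ tail A r) → wtSet wt B ≤ℚ wtSet wt A
  wtSet-mono {B} {A} |B|≡|A| B≤A = weight-mono (elemsOf B) (elemsOf A) |B|≡|A| refl
    (λ r → subst₂ _≤_ (sym (rankTail≡tail B r)) (sym (rankTail≡tail A r)) (B≤A r))

  wtSet-strict : ∀ {B A} → size B ≡ size A → (∀ r → tail B r ≤ tail A r) → ∀ r → tail B r < tail A r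
               → wtSet wt B <ℚ wtSet wt A
  wtSet-strict {B} {A} |B|≡|A| B≤A r B<A = weight-strict (elemsOf B) (elemsOf A) |B|≡|A| refl
    (λ r → subst₂ _≤_ (sym (rankTail≡tail B r)) (sym (rankTail≡tail A r)) (B≤A r)) r
    (subst₂ _<_ (sym (rankTail≡tail B r)) (sym (rankTail≡tail A r)) B<A)

  size≡tail : ∀ S → size S ≡ tail S 0
  size≡tail S = size≡regionTail S ≤-refl (n≤1+n n)

  size-bound : ∀ S → size S ≤ n * suc n
  size-bound S = subst (_≤ n * suc n) (sym (size≡tail S))
    (≤-trans (regionTail-≤ (toRegion-within S) 0 ≤-refl (n≤1+n n)) (≤-reflexive (*-comm (suc n) n)))

  downset-≤-filled : ∀ {B} → Downset B → ∀ r → tail B r ≤ regionTail (filled (suc n) (size B)) r (suc n)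
  downset-≤-filled {B} B-down r = subst (λ m → tail B r ≤ regionTail (filled (suc n) m) r (suc n)) (sym (size≡tail B))
    (compress (suc n) n (n≤1+n n) (toRegion B) (toRegion-down B-down) (toRegion-within B) r)

  optimal-if-dominant : ∀ {A} → Downset A → (∀ r → regionTail (filled (suc n) (size A)) r (suc n) ≤ tail A r) → Optimal wt A
  optimal-if-dominant {A} A-down dominant = A-down , λ B B-down |B|≡|A| → wtSet-mono |B|≡|A|
    (λ r → ≤-trans (subst (λ m → tail B r ≤ regionTail (filled (suc n) m) r (suc n)) |B|≡|A| (downset-≤-filled B-down r))
                   (dominant r))

  tail-fromRegion : ∀ {A D} → (∀ p → A p ≡ fromRegion D p) → Within D (suc n) n → ∀ r → tail A r ≡ regionTail D r (suc n)
  tail-fromRegion A≗D D⊆ r = regionTail-cong (λ a b → trans (toRegion-cong A≗D a b) (toRegion-fromRegion D⊆ a b)) r (suc n)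

  C-segment-optimal : ∀ {A} → Downset A → IsInitialSegment _<C_ A (size A) → Optimal wt A
  C-segment-optimal {A} A-down segment = optimal-if-dominant A-down
    (λ r → ≤-reflexive (sym (tail-fromRegion (C-segment segment) (filled-within (size-bound A)) r)))

  L-segment-tail : ∀ {A} → IsInitialSegment _<L_ A (size A) → ∀ r → tail A r ≡ regionTail (filled n (size A)) r (suc n)
  L-segment-tail {A} segment r = trans
    (tail-fromRegion (L-segment segment)
      (Within-transpose (filled-within (subst (size A ≤_) (*-comm n (suc n)) (size-bound A)))) r)
    (regionTail-transpose (filled n (size A)) r (suc n))

  L-segment-optimal : ∀ {A} .{{_ : NonZero n}} → Downset A → IsInitialSegment _<L_ A (size A)
    → LOptimalSize n (size A) → Optimal wt A
  L-segment-optimal {A} A-down segment condition with LOptimalSize⇒degenerateSplit n (size A) (size-bound A) condition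
  ... | q , s , q≤n , s≤n , |A|≡ , degenerate = optimal-if-dominant A-down λ r → ≤-reflexive (begin
    regionTail (filled (suc n) (size A)) r (suc n)     ≡⟨ cong (λ m → regionTail (filled (suc n) m) r (suc n)) |A|≡ ⟩
    regionTail (filled (suc n) (q * n + s)) r (suc n)  ≡⟨ widen-preserves q s q≤n s≤n degenerate r ⟩
    regionTail (filled n (q * n + s)) r (suc n)        ≡⟨ cong (λ m → regionTail (filled n m) r (suc n)) |A|≡ ⟨
    regionTail (filled n (size A)) r (suc n)           ≡⟨ L-segment-tail segment r ⟨
    tail A r ∎)
    where open ≡-Reasoning

  L-segment-suboptimal : ∀ {A} → Downset A → IsInitialSegment _<L_ A (size A)
    → ∀ q s → 0 < q ⊓ s → q ⊔ s < n → size A ≡ q * n + s → ¬ Optimal wt A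
  L-segment-suboptimal {A} A-down segment q s 0<q⊓s q⊔s<n |A|≡ (_ , optimal) =
    ℚ.<-irrefl refl (ℚ.<-≤-trans (wtSet-strict (sym C-size) A≤C r A<C)
                                 (optimal C (fromRegion-down (filled-down {suc n} {m})) C-size))
    where
      m : ℕ
      m = size A
      C : SubsetM (suc n) n
      C = fromRegion (filled (suc n) m)
      C-tail : ∀ r → tail C r ≡ regionTail (filled (suc n) m) r (suc n)
      C-tail = tail-fromRegion {C} {filled (suc n) m} (λ _ → refl) (filled-within (size-bound A))
      C-size : size C ≡ m
      C-size = trans (size≡tail C) (trans (C-tail 0)
        (filled-size {suc n} {suc n} m ≤-refl (≤-trans (s≤s (size-bound A)) (s≤s (m≤n+m (n * suc n) n)))))
      A≤C : ∀ r → tail A r ≤ tail C r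
      A≤C r = subst (tail A r ≤_) (sym (C-tail r)) (downset-≤-filled A-down r)
      gap : ∃[ r ] regionTail (filled n (q * n + s)) r (suc n) < regionTail (filled (suc n) (q * n + s)) r (suc n)
      gap = widen-strict q s 0<q⊓s q⊔s<n
      r : ℕ
      r = proj₁ gap
      A<C : tail A r < tail C r
      A<C = subst₂ _<_ (sym (trans (L-segment-tail segment r) (cong (λ m → regionTail (filled n m) r (suc n)) |A|≡)))
                       (sym (trans (C-tail r) (cong (λ m → regionTail (filled (suc n) m) r (suc n)) |A|≡)))
                       (proj₂ gap)

  L-segment-optimal⇔ : ∀ {A} .{{_ : NonZero n}} → Downset A → IsInitialSegment _<L_ A (size A)
    → Optimal wt A ⇔ LOptimalSize n (size A)
  L-segment-optimal⇔ {A} A-down segment = mk⇔ necessary (L-segment-optimal A-down segment)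
    where
      necessary : Optimal wt A → LOptimalSize n (size A)
      necessary optimal with LOptimalSize⊎strictSplit n (size A)
      ... | inj₁ condition = condition
      ... | inj₂ (q , s , 0<q⊓s , q⊔s<n , |A|≡) =
        ⊥-elim (L-segment-suboptimal A-down segment q s 0<q⊓s q⊔s<n |A|≡ optimal)

corollary4p5 : (ℓ₁ ℓ₂ : ℕ) → 1 < ℓ₂ → ℓ₂ ≡ ℓ₁ ∸ 1
    → (wt : Weight ℓ₁ ℓ₂) → RankIncreasing wt → RankConstant wt
    → (A : SubsetM ℓ₁ ℓ₂) → Downset A
    → (IsInitialSegment _<L_ A (size A)
        → Optimal wt A ⇔ (size A ≤ ℓ₂ ⊎ ℓ₂ * (ℓ₁ ∸ 1) ≤ size A ⊎ ∃ λ (k : ℕ) → size A ≡ k * ℓ₂))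
    × (IsInitialSegment _<C_ A (size A) → Optimal wt A)
corollary4p5 zero .0 () refl
corollary4p5 (suc n) .n 1<n refl wt increasing constant A A-down =
  L-segment-optimal⇔ A-down , C-segment-optimal A-down
  where
    open Optimality wt increasing constant
    instance
      n≢0 : NonZero n
      n≢0 = >-nonZero (<-trans z<s 1<n)
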